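{- Let $R\subseteq\{0,1,2\}^2$ contain the boxes $(0,2),(1,2),(2,2)$. (i) Let $R'=\{(0,2),(1,2),(2,2)\}\cup\{(a,1-b): (a,b)\in R,\ b\in\{0,1\}\}$. Then the mesh patterns $(12,R)$ and $(12,R')$ are equidistributed. (ii) If moreover $(2,0)\notin R$ and $(2,1)\notin R$, let $R''=\{(0,2),(1,2),(2,2)\}\cup\{(1-a,b): (a,b)\in R,\ a,b\in\{0,1\}\}$. Then the mesh patterns $(12,R)$ and $(12,R'')$ are equidistributed.
   Context: A mesh pattern $(12,R)$ of length $2$ has $R\subseteq\{0,1,2\}^2$ (shaded boxes). For $\pi=\pi_1\cdots\pi_n\in S_n$, an occurrence of $(12,R)$ in $\pi$ is a pair of positions $i_1<i_2$ with $\pi_{i_1}<\pi_{i_2}$ such that, setting $x_0=0,x_1=i_1,x_2=i_2,x_3=n+1$ and $y_0=0,y_1=\pi_{i_1},y_2=\pi_{i_2},y_3=n+1$, for every $(a,b)\in R$ there is no index $k$ with $x_a<k<x_{a+1}$ and $y_b<\pi_k<y_{b+1}$. Let $s_{n,k}(p)$ be the number of $\pi\in S_n$ with exactly $k$ occurrences of $p$; patterns $p_1,p_2$ are equidistributed if $s_{n,k}(p_1)=s_{n,k}(p_2)$ for all $n,k\ge0$. -}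

module Defs where

open import Data.Nat using (ℕ; zero; suc; _+_; _<_; _<ᵇ_)
open import Data.Bool using (Bool; true; false; _∧_; _∨_; not; if_then_else_)
open import Data.Fin using (Fin; toℕ; zero; suc)
open import Data.Fin.Properties using (_≟_)
open import Data.Vec using (Vec; []; _∷_; lookup)
open import Data.List using (List; []; _∷_; map; concatMap; filter; length; allFin)
open import Data.Bool.ListAction using (all; any)
open import Data.Product using (_×_; _,_)
open import Relation.Nullary.Decidable using (⌊_⌋)
open import Function using (_∘_)

Shading : Set
Shading = Fin 3 → Fin 3 → Bool

words : (m n : ℕ) → List (Vec (Fin m) n)
words m zero    = [] ∷ []
words m (suc n) = concatMap (λ x → map (x ∷_) (words m n)) (allFin m)

isPerm : ∀ {n} → Vec (Fin n) n → Bool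
isPerm {n} w = all (λ i → all (λ j → ⌊ i ≟ j ⌋ ∨ not ⌊ lookup w i ≟ lookup w j ⌋)
                                (allFin n)) (allFin n)

-- The symmetric group S_n: all permutations of {1..n}; π is stored 0-based,
-- i.e. position i (0-based) holds value π_{i+1} - 1.
perms : (n : ℕ) → List (Vec (Fin n) n)
perms n = filter (λ w → Data.Bool._≟_ (isPerm w) true) (words n n)

val : ∀ {n} → Vec (Fin n) n → Fin n → ℕ
val π k = suc (toℕ (lookup π k))

pos : ∀ {n} → Fin n → ℕ
pos k = suc (toℕ k)

btw : ℕ → ℕ → ℕ → Bool
btw a x b = (a <ᵇ x) ∧ (x <ᵇ b)

-- Coordinates x_0..x_3 / y_0..y_3 of an occurrence at (1-based) positions i₁,i₂
-- with values v₁,v₂, in S_n.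
coord : ℕ → ℕ → ℕ → Fin 4 → ℕ
coord n c₁ c₂ zero                   = 0
coord n c₁ c₂ (suc zero)             = c₁
coord n c₁ c₂ (suc (suc zero))       = c₂
coord n c₁ c₂ (suc (suc (suc zero))) = suc n

inj : Fin 3 → Fin 4
inj = Data.Fin.inject₁

sucF : Fin 3 → Fin 4
sucF = suc

boxEmpty : ∀ {n} → Vec (Fin n) n → Fin n → Fin n → Fin 3 → Fin 3 → Bool
boxEmpty {n} π i₁ i₂ a b =
  not (any (λ k → btw (coord n (pos i₁) (pos i₂) (inj a)) (pos k) (coord n (pos i₁) (pos i₂) (sucF a))
                ∧ btw (coord n (val π i₁) (val π i₂) (inj b)) (val π k) (coord n (val π i₁) (val π i₂) (sucF b)))
           (allFin n))

allBoxes : List (Fin 3 × Fin 3)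
allBoxes = concatMap (λ a → map (a ,_) (allFin 3)) (allFin 3)

isOcc : ∀ {n} → Shading → Vec (Fin n) n → Fin n → Fin n → Bool
isOcc R π i₁ i₂ =
  (toℕ i₁ <ᵇ toℕ i₂) ∧ (val π i₁ <ᵇ val π i₂)
  ∧ all (λ { (a , b) → not (R a b) ∨ boxEmpty π i₁ i₂ a b }) allBoxes

occ : ∀ {n} → Shading → Vec (Fin n) n → ℕ
occ {n} R π = length (filter (λ { (i , j) → Data.Bool._≟_ (isOcc R π i j) true })
                             (concatMap (λ i → map (i ,_) (allFin n)) (allFin n)))

s : Shading → ℕ → ℕ → ℕ
s R n k = length (filter (λ π → Data.Nat._≟_ (occ R π) k) (perms n))

Equidistributed : Shading → Shading → Set
Equidistributed R₁ R₂ = ∀ n k → s R₁ n k ≡ s R₂ n k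
  where open import Relation.Binary.PropositionalEquality using (_≡_)

topShaded : Shading → Set
topShaded R = ∀ a → R a (suc (suc zero)) ≡ true
  where open import Relation.Binary.PropositionalEquality using (_≡_)

two : Fin 3
two = suc (suc zero)

flip01 : Fin 3 → Fin 3
flip01 zero = suc zero
flip01 (suc zero) = zero
flip01 (suc (suc zero)) = suc (suc zero)

R′ : Shading → Shading
R′ R a (suc (suc zero)) = true
R′ R a b = R a (flip01 b)

R″ : Shading → Shading
R″ R a (suc (suc zero)) = true
R″ R (suc (suc zero)) b = false
R″ R a b = R (flip01 a) b

-- An occurrence (i, j) of a pattern with shaded top row must end at the maximum n of π,
-- for otherwise the position of n would lie in a shaded top box.  Relative to such an
-- occurrence, complementing the values below n (v ↦ n − v) fixes the columns and swaps
-- the two lower rows, while reversing the prefix of π before n fixes the rows and swaps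
-- the two left columns; the column after n stays where it is, which is why (ii) needs
-- it unshaded below the top.  Both maps are involutions of S_n that carry the
-- occurrences of (12, R) in π bijectively to those of (12, R′), resp. (12, R″), in the
-- image, so they preserve the number of permutations with k occurrences.
module Submission where

open import Defs
open import Data.Bool using (Bool; true; false; T; _∧_; _∨_; not)
open import Data.Bool.ListAction using (all; any)
open import Data.Bool.Properties using (T-∧; T-∨; T-≡; T-not-≡)
open import Data.Empty using (⊥-elim)
open import Data.Fin using (Fin; zero; suc; toℕ; fromℕ; fromℕ<; punchOut)
import Data.Fin.Properties as Fin
open import Data.List
  using ( List; []; _∷_; _++_; map; filter; length; concatMap; allFin
        ; cartesianProductWith; cartesianProduct)
open import Data.List.Membership.Propositional using (_∈_; lose)
open import Data.List.Membership.Propositional.Properties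
  using ( ∈-map⁺; ∈-map⁻; ∈-allFin; ∈-filter⁺; ∈-filter⁻
        ; ∈-cartesianProduct⁺; ∈-cartesianProductWith⁺)
open import Data.List.Membership.Propositional.Properties.WithK using (unique∧set⇒bag)
open import Data.List.Relation.Binary.BagAndSetEquality using (∼bag⇒↭)
open import Data.List.Relation.Binary.Permutation.Propositional using (_↭_)
open import Data.List.Relation.Binary.Permutation.Propositional.Properties
  using (↭-length; filter-↭)
import Data.List.Relation.Unary.All as All
import Data.List.Relation.Unary.All.Properties as All
open import Data.List.Relation.Unary.Any using (here; there; satisfied)
open import Data.List.Relation.Unary.Any.Properties using (any⁺; any⁻)
open import Data.List.Relation.Unary.Unique.Propositional using (Unique; []; _∷_)
import Data.List.Relation.Unary.Unique.Propositional.Properties as Unique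
open import Data.Nat using (ℕ; zero; suc; _∸_; _<_; _≤_; _<?_; _<ᵇ_; s≤s; z<s; s<s)
open import Data.Nat.Properties
  using ( _≟_; suc-injective; <ᵇ⇒<; <⇒<ᵇ; <-cmp; <-irrefl; <-trans; <-≤-trans; ≤-<-trans; ≤-refl
        ; ≤-reflexive; <⇒≤; <⇒≱; ≮⇒≥; ≤∧≢⇒<; n<1+n; m∸n≤m; m∸[m∸n]≡n; m<n⇒0<n∸m; ∸-monoʳ-<
        ; +-∸-assoc; module ≤-Reasoning)
open import Data.Product using (_×_; _,_; ∃; proj₁; proj₂)
import Data.Product as Product
open import Data.Sum using (inj₁; inj₂)
open import Data.Vec as Vec using (Vec; []; _∷_; lookup; tabulate)
import Data.Vec.Properties as Vecₚ
open import Function using (_⇔_; mk⇔; Equivalence; id; _∘′_; _$_)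
open import Function.Construct.Composition using (_⇔-∘_)
open import Function.Construct.Symmetry using (⇔-sym)
open import Function.Definitions using (Injective; Surjective)
open import Relation.Binary.Definitions using (tri<; tri≈; tri>)
open import Relation.Binary.PropositionalEquality
open import Relation.Nullary using (Dec; yes; no; ¬_; contradiction)
open import Relation.Nullary.Decidable using (⌊_⌋)
open import Relation.Unary using (Pred; Decidable)

private variable
  n N t x y z : ℕ

module _ {a b c} {A : Set a} {B : Set b} {C : Set c} where

  concatMap-map≡cartesianProductWith : ∀ (f : A → B → C) xs ys →
    concatMap (λ x → map (f x) ys) xs ≡ cartesianProductWith f xs ys
  concatMap-map≡cartesianProductWith f []       ys = refl
  concatMap-map≡cartesianProductWith f (x ∷ xs) ys =
    cong (map (f x) ys ++_) (concatMap-map≡cartesianProductWith f xs ys)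

module _ {a} {A : Set a} {f : A → A} where

  unique-map⁺ : ∀ {xs} → (∀ {x y} → x ∈ xs → y ∈ xs → f x ≡ f y → x ≡ y) →
                Unique xs → Unique (map f xs)
  unique-map⁺ inj []           = []
  unique-map⁺ inj (x∉xs ∷ xs!) =
    All.map⁺ (All.tabulate λ y∈xs fx≡fy →
               All.lookup x∉xs y∈xs (inj (here refl) (there y∈xs) fx≡fy))
    ∷ unique-map⁺ (λ x∈ y∈ → inj (there x∈) (there y∈)) xs!

  map-involution-↭ : ∀ {xs} → Unique xs → (∀ {x} → x ∈ xs → f x ∈ xs) →
                     (∀ {x} → x ∈ xs → f (f x) ≡ x) → map f xs ↭ xs
  map-involution-↭ {xs} xs! closed involutive =
    ∼bag⇒↭ (unique∧set⇒bag (unique-map⁺ injective xs!) xs! (mk⇔ to from))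
    where
    injective : ∀ {x y} → x ∈ xs → y ∈ xs → f x ≡ f y → x ≡ y
    injective x∈ y∈ fx≡fy = trans (sym (involutive x∈)) (trans (cong f fx≡fy) (involutive y∈))
    to : ∀ {x} → x ∈ map f xs → x ∈ xs
    to x∈ with y , y∈ , refl ← ∈-map⁻ f x∈ = closed y∈
    from : ∀ {x} → x ∈ xs → x ∈ map f xs
    from x∈ = subst (_∈ map f xs) (involutive x∈) (∈-map⁺ f (closed x∈))

module _ {a p q} {A : Set a} {P : Pred A p} {Q : Pred A q}
         (P? : Decidable P) (Q? : Decidable Q) {f : A → A} where

  length-filter-map : ∀ xs → (∀ {x} → x ∈ xs → P x ⇔ Q (f x)) →
                      length (filter Q? (map f xs)) ≡ length (filter P? xs)
  length-filter-map []       P⇔Qf = refl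
  length-filter-map (x ∷ xs) P⇔Qf with P? x | Q? (f x)
  ... | yes _   | yes _   = cong suc (length-filter-map xs (P⇔Qf ∘′ there))
  ... | no _    | no _    = length-filter-map xs (P⇔Qf ∘′ there)
  ... | yes Px  | no ¬Qfx = contradiction (Equivalence.to (P⇔Qf (here refl)) Px) ¬Qfx
  ... | no ¬Px  | yes Qfx = contradiction (Equivalence.from (P⇔Qf (here refl)) Qfx) ¬Px

  length-filter-involution : ∀ {xs} → Unique xs → (∀ {x} → x ∈ xs → f x ∈ xs) →
    (∀ {x} → x ∈ xs → f (f x) ≡ x) → (∀ {x} → x ∈ xs → P x ⇔ Q (f x)) →
    length (filter P? xs) ≡ length (filter Q? xs)
  length-filter-involution {xs} xs! closed involutive P⇔Qf = begin
    length (filter P? xs)          ≡⟨ length-filter-map xs P⇔Qf ⟨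
    length (filter Q? (map f xs))  ≡⟨ ↭-length (filter-↭ Q? map-f-↭) ⟩
    length (filter Q? xs)          ∎
    where
    open ≡-Reasoning
    map-f-↭ : map f xs ↭ xs
    map-f-↭ = map-involution-↭ xs! closed involutive

involutive⇒injective : ∀ {a} {A : Set a} (f : A → A) → (∀ x → f (f x) ≡ x) → Injective _≡_ _≡_ f
involutive⇒injective f involutive {x} {y} fx≡fy =
  trans (sym (involutive x)) (trans (cong f fx≡fy) (involutive y))

T-btw : T (btw x y z) ⇔ (x < y × y < z)
T-btw {x} {y} {z} = mk⇔
  (λ t → let x<ᵇy , y<ᵇz = Equivalence.to T-∧ t in <ᵇ⇒< x y x<ᵇy , <ᵇ⇒< y z y<ᵇz)
  (λ (x<y , y<z) → Equivalence.from T-∧ (<⇒<ᵇ x<y , <⇒<ᵇ y<z))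

flip01-involutive : ∀ a → flip01 (flip01 a) ≡ a
flip01-involutive zero             = refl
flip01-involutive (suc zero)       = refl
flip01-involutive (suc (suc zero)) = refl

band : ℕ → ℕ → ℕ → Fin 3 → ℕ → Bool
band N x₁ x₂ a z = btw (coord N x₁ x₂ (inj a)) z (coord N x₁ x₂ (sucF a))

band-cong : ∀ N a {x₁ y₁ x₂ y₂ z w} → x₁ ≡ y₁ → x₂ ≡ y₂ → z ≡ w →
            band N x₁ x₂ a z ≡ band N y₁ y₂ a w
band-cong N a refl refl refl = refl

reflect : ℕ → ℕ → ℕ
reflect t y with y <? t
... | yes _ = t ∸ y
... | no  _ = y

reflect-< : y < t → reflect t y ≡ t ∸ y
reflect-< {y} {t} y<t with y <? t
... | yes _   = refl
... | no y≮t = contradiction y<t y≮t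

reflect-≥ : t ≤ y → reflect t y ≡ y
reflect-≥ {t} {y} t≤y with y <? t
... | yes y<t = contradiction t≤y (<⇒≱ y<t)
... | no _    = refl

reflect-involutive : ∀ t → 0 < y → reflect t (reflect t y) ≡ y
reflect-involutive {y} t 0<y with y <? t
... | yes y<t = trans (reflect-< (∸-monoʳ-< 0<y (<⇒≤ y<t))) (m∸[m∸n]≡n (<⇒≤ y<t))
... | no y≮t  = reflect-≥ (≮⇒≥ y≮t)

band-reflect : ∀ a → x < t →
               T (band N (reflect t x) t a z) → T (band N x t (flip01 a) (reflect t z))
band-reflect {x} {t} {N} {z} zero x<t z∈band =
  subst (λ r → T (btw x r t)) (sym (reflect-< z<t)) (Equivalence.from T-btw (x<t∸z , t∸z<t))
  where
  z-in : 0 < z × z < t ∸ x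
  z-in = Equivalence.to T-btw (subst (λ r → T (btw 0 z r)) (reflect-< x<t) z∈band)
  z<t : z < t
  z<t = <-≤-trans (proj₂ z-in) (m∸n≤m t x)
  x<t∸z : x < t ∸ z
  x<t∸z = subst (_< t ∸ z) (m∸[m∸n]≡n (<⇒≤ x<t)) (∸-monoʳ-< (proj₂ z-in) (m∸n≤m t x))
  t∸z<t : t ∸ z < t
  t∸z<t = ∸-monoʳ-< (proj₁ z-in) (<⇒≤ z<t)
band-reflect {x} {t} {N} {z} (suc zero) x<t z∈band =
  subst (λ r → T (btw 0 r x)) (sym (reflect-< (proj₂ z-in)))
    (Equivalence.from T-btw (0<t∸z , t∸z<x))
  where
  z-in : t ∸ x < z × z < t
  z-in = Equivalence.to T-btw (subst (λ r → T (btw r z t)) (reflect-< x<t) z∈band)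
  0<t∸z : 0 < t ∸ z
  0<t∸z = m<n⇒0<n∸m (proj₂ z-in)
  t∸z<x : t ∸ z < x
  t∸z<x = subst (t ∸ z <_) (m∸[m∸n]≡n (<⇒≤ x<t)) (∸-monoʳ-< (proj₁ z-in) (<⇒≤ (proj₂ z-in)))
band-reflect {x} {t} {N} {z} (suc (suc zero)) x<t z∈band =
  subst (λ r → T (btw t r (suc N))) (sym (reflect-≥ (<⇒≤ t<z))) z∈band
  where
  t<z : t < z
  t<z = proj₁ (Equivalence.to (T-btw {y = z} {z = suc N}) z∈band)

pos-injective : {i j : Fin n} → pos i ≡ pos j → i ≡ j
pos-injective = Fin.toℕ-injective ∘′ suc-injective

reflectBelow : Fin n → Fin n → Fin n
reflectBelow p k with toℕ k <? toℕ p
... | yes _ = fromℕ< (≤-<-trans (m∸n≤m (toℕ p) (suc (toℕ k))) (Fin.toℕ<n p))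
... | no  _ = k

pos-reflectBelow : (p k : Fin n) → pos (reflectBelow p k) ≡ reflect (pos p) (pos k)
pos-reflectBelow p k with toℕ k <? toℕ p
... | yes k<p = begin
  suc (toℕ (fromℕ< _))       ≡⟨ cong suc (Fin.toℕ-fromℕ< _) ⟩
  suc (toℕ p ∸ suc (toℕ k))  ≡⟨ +-∸-assoc 1 k<p ⟨
  suc (toℕ p) ∸ suc (toℕ k)  ≡⟨ reflect-< (s<s k<p) ⟨
  reflect (pos p) (pos k)    ∎
  where open ≡-Reasoning
... | no k≮p = sym (reflect-≥ (s≤s (≮⇒≥ k≮p)))

reflectBelow-involutive : (p k : Fin n) → reflectBelow p (reflectBelow p k) ≡ k
reflectBelow-involutive p k = pos-injective (begin
  pos (reflectBelow p (reflectBelow p k))    ≡⟨ pos-reflectBelow p _ ⟩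
  reflect (pos p) (pos (reflectBelow p k))   ≡⟨ cong (reflect (pos p)) (pos-reflectBelow p k) ⟩
  reflect (pos p) (reflect (pos p) (pos k))  ≡⟨ reflect-involutive (pos p) z<s ⟩
  pos k                                      ∎)
  where open ≡-Reasoning

reflectBelow-self : (p : Fin n) → reflectBelow p p ≡ p
reflectBelow-self p = pos-injective (trans (pos-reflectBelow p p) (reflect-≥ ≤-refl))

reflectBelow-< : (p k : Fin n) → pos k < pos p → pos (reflectBelow p k) < pos p
reflectBelow-< p k k<p = begin-strict
  pos (reflectBelow p k)   ≡⟨ pos-reflectBelow p k ⟩
  reflect (pos p) (pos k)  ≡⟨ reflect-< k<p ⟩
  pos p ∸ pos k            <⟨ ∸-monoʳ-< z<s (<⇒≤ k<p) ⟩
  pos p                    ∎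
  where open ≤-Reasoning

Word : ℕ → Set
Word n = Vec (Fin n) n

IsPermutation : Word n → Set
IsPermutation π = Injective _≡_ _≡_ (lookup π)

allPairs : ∀ n → List (Fin n × Fin n)
allPairs n = concatMap (λ i → map (i ,_) (allFin n)) (allFin n)

allPairs≡cartesianProduct : ∀ n → allPairs n ≡ cartesianProduct (allFin n) (allFin n)
allPairs≡cartesianProduct n = concatMap-map≡cartesianProductWith _,_ (allFin n) (allFin n)

allPairs-unique : ∀ n → Unique (allPairs n)
allPairs-unique n rewrite allPairs≡cartesianProduct n =
  Unique.cartesianProduct⁺ (Unique.allFin⁺ n) (Unique.allFin⁺ n)

∈-allPairs : (i j : Fin n) → (i , j) ∈ allPairs n
∈-allPairs {n} i j rewrite allPairs≡cartesianProduct n =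
  ∈-cartesianProduct⁺ (∈-allFin i) (∈-allFin j)

words-suc : ∀ m n → words m (suc n) ≡ cartesianProductWith _∷_ (allFin m) (words m n)
words-suc m n = concatMap-map≡cartesianProductWith _∷_ (allFin m) (words m n)

words-unique : ∀ m n → Unique (words m n)
words-unique m zero                          = All.[] ∷ []
words-unique m (suc n) rewrite words-suc m n =
  Unique.cartesianProductWith⁺ _∷_ Vecₚ.∷-injective (Unique.allFin⁺ m) (words-unique m n)

∈-words : ∀ {m n} (w : Vec (Fin m) n) → w ∈ words m n
∈-words []                                        = here refl
∈-words {m} {suc n} (x ∷ w) rewrite words-suc m n =
  ∈-cartesianProductWith⁺ _∷_ (∈-allFin x) (∈-words w)

isPerm⇔IsPermutation : {π : Word n} → T (isPerm π) ⇔ IsPermutation π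
isPerm⇔IsPermutation {n} {π} = mk⇔ to from
  where
  separated : Fin n → Fin n → Bool
  separated i j = ⌊ i Fin.≟ j ⌋ ∨ not ⌊ lookup π i Fin.≟ lookup π j ⌋
  to : T (isPerm π) → IsPermutation π
  to t {i} {j} πi≡πj = decide (All.lookup (All.all⁺ (separated i) (allFin n) row) (∈-allFin j))
    where
    row : T (all (separated i) (allFin n))
    row = All.lookup (All.all⁺ (λ i → all (separated i) (allFin n)) (allFin n) t) (∈-allFin i)
    decide : T (separated i j) → i ≡ j
    decide with i Fin.≟ j | lookup π i Fin.≟ lookup π j
    ... | yes i≡j | _        = λ _ → i≡j
    ... | no _    | yes _    = λ ()
    ... | no _    | no πi≢πj = contradiction πi≡πj πi≢πj
  from : IsPermutation π → T (isPerm π)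
  from injective = All.all⁻ (λ i → all (separated i) (allFin n)) {allFin n}
    (All.tabulate λ {i} _ →
       All.all⁻ (separated i) {allFin n} (All.tabulate λ {j} _ → distinct i j))
    where
    distinct : ∀ i j → T (separated i j)
    distinct i j with i Fin.≟ j | lookup π i Fin.≟ lookup π j
    ... | yes _   | _          = _
    ... | no _    | no _       = _
    ... | no i≢j  | yes πi≡πj = i≢j (injective πi≡πj)

perms-unique : ∀ n → Unique (perms n)
perms-unique n = Unique.filter⁺ _ (words-unique n n)

∈-perms⁺ : {π : Word n} → IsPermutation π → π ∈ perms n
∈-perms⁺ {π = π} π-perm =
  ∈-filter⁺ _ (∈-words π)
    (Equivalence.to T-≡ (Equivalence.from (isPerm⇔IsPermutation {π = π}) π-perm))

∈-perms⁻ : {π : Word n} → π ∈ perms n → IsPermutation π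
∈-perms⁻ {n} {π} π∈ =
  Equivalence.to (isPerm⇔IsPermutation {π = π})
    (Equivalence.from T-≡ (proj₂ (∈-filter⁻ _ {xs = words n n} π∈)))

injective⇒surjective : {f : Fin n → Fin n} → Injective _≡_ _≡_ f → Surjective _≡_ _≡_ f
injective⇒surjective {suc m} {f} f-injective y with Fin.any? (λ x → f x Fin.≟ y)
... | yes (x , fx≡y) = x , λ { refl → fx≡y }
... | no y∉image =
  let i , j , i<j , gi≡gj = Fin.pigeonhole (n<1+n m) g
  in contradiction (f-injective (Fin.punchOut-injective y≢f y≢f gi≡gj)) (Fin.<⇒≢ i<j)
  where
  y≢f : ∀ {x} → y ≢ f x
  y≢f {x} y≡fx = y∉image (x , sym y≡fx)
  g : Fin (suc m) → Fin m
  g x = punchOut (y≢f {x})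

maximum-attained : ∀ {m} {π : Word (suc m)} → IsPermutation π → ∃ λ k → val π k ≡ suc m
maximum-attained {m} π-perm with k , hit ← injective⇒surjective π-perm (fromℕ m) =
  k , cong suc (trans (cong toℕ (hit refl)) (Fin.toℕ-fromℕ m))

inColumn : Fin n → Fin n → Fin 3 → Fin n → Bool
inColumn {n} i j a k = band n (pos i) (pos j) a (pos k)

inRow : Word n → Fin n → Fin n → Fin 3 → Fin n → Bool
inRow {n} π i j b k = band n (val π i) (val π j) b (val π k)

inBox : Word n → Fin n → Fin n → Fin 3 → Fin 3 → Fin n → Bool
inBox π i j a b k = inColumn i j a k ∧ inRow π i j b k

ShadedBoxesEmpty : Shading → Word n → Fin n → Fin n → Set
ShadedBoxesEmpty R π i j = ∀ a b → T (R a b) → ∀ k → ¬ T (inBox π i j a b k)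

record Occurrence (R : Shading) (π : Word n) (i j : Fin n) : Set where
  field
    positions<  : pos i < pos j
    values<     : val π i < val π j
    shadedEmpty : ShadedBoxesEmpty R π i j

isOcc⇔Occurrence : ∀ {R} {π : Word n} {i j} → T (isOcc R π i j) ⇔ Occurrence R π i j
isOcc⇔Occurrence {n} {R} {π} {i} {j} = mk⇔ to from
  where
  allowed : Fin 3 × Fin 3 → Bool
  allowed (a , b) = not (R a b) ∨ boxEmpty π i j a b
  to : T (isOcc R π i j) → Occurrence R π i j
  to t = record
    { positions<  = <ᵇ⇒< (pos i) (pos j) i<ᵇj
    ; values<     = <ᵇ⇒< (val π i) (val π j) πi<ᵇπj
    ; shadedEmpty = λ a b Rab k k∈box →
                      empty a b Rab (any⁺ (inBox π i j a b) (lose (∈-allFin k) k∈box))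
    }
    where
    i<ᵇj : T (toℕ i <ᵇ toℕ j)
    i<ᵇj = proj₁ (Equivalence.to (T-∧ {toℕ i <ᵇ toℕ j}) t)
    rest : T ((val π i <ᵇ val π j) ∧ all allowed allBoxes)
    rest = proj₂ (Equivalence.to (T-∧ {toℕ i <ᵇ toℕ j}) t)
    πi<ᵇπj : T (val π i <ᵇ val π j)
    πi<ᵇπj = proj₁ (Equivalence.to (T-∧ {val π i <ᵇ val π j}) rest)
    boxes : All.All (T ∘′ allowed) allBoxes
    boxes = All.all⁺ allowed allBoxes (proj₂ (Equivalence.to (T-∧ {val π i <ᵇ val π j}) rest))
    empty : ∀ a b → T (R a b) → ¬ T (any (inBox π i j a b) (allFin n))
    empty a b Rab nonempty
      with Equivalence.to (T-∨ {not (R a b)}) (All.lookup boxes (∈-allPairs a b))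
    ... | inj₁ unshaded = subst T (Equivalence.to T-not-≡ unshaded) Rab
    ... | inj₂ emptyBox = subst T (Equivalence.to T-not-≡ emptyBox) nonempty
  from : Occurrence R π i j → T (isOcc R π i j)
  from occurrence = Equivalence.from T-∧ (<⇒<ᵇ positions< , Equivalence.from T-∧ (<⇒<ᵇ values< ,
    All.all⁻ allowed {allBoxes} (All.tabulate λ { {a , b} _ → box a b })))
    where
    open Occurrence occurrence
    box : ∀ a b → T (allowed (a , b))
    box a b with R a b in Rab | any (inBox π i j a b) (allFin n) in nonempty
    ... | false | _     = _
    ... | true  | false = _
    ... | true  | true
      with k , k∈box ← satisfied (any⁻ (inBox π i j a b) (allFin n) (subst T (sym nonempty) _)) =
      shadedEmpty a b (subst T (sym Rab) _) k k∈box

column-cover : {i j k : Fin n} → k ≢ i → k ≢ j → ∃ λ a → T (inColumn i j a k)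
column-cover {n} {i} {j} {k} k≢i k≢j with <-cmp (pos k) (pos i)
... | tri< k<i _ _ = zero , Equivalence.from T-btw (z<s , k<i)
... | tri≈ _ k≡i _ = contradiction (pos-injective k≡i) k≢i
... | tri> _ _ i<k with <-cmp (pos k) (pos j)
...   | tri< k<j _ _ = suc zero , Equivalence.from T-btw (i<k , k<j)
...   | tri≈ _ k≡j _ = contradiction (pos-injective k≡j) k≢j
...   | tri> _ _ j<k = suc (suc zero) , Equivalence.from T-btw (j<k , s<s (Fin.toℕ<n k))

occurrence⇒maximum : ∀ {R} {π : Word n} {i j} → topShaded R → IsPermutation π →
                     Occurrence R π i j → val π j ≡ n
occurrence⇒maximum {suc m} {R} {π} {i} {j} top π-perm occurrence with val π j ≟ suc m
... | yes πj≡n = πj≡n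
... | no πj≢n  = ⊥-elim $ shadedEmpty a two (subst T (sym (top a)) _) k
                            (Equivalence.from (T-∧ {inColumn i j a k}) (k∈column , k∈topRow))
  where
  open Occurrence occurrence
  k : Fin (suc m)
  k = proj₁ (maximum-attained {π = π} π-perm)
  πk≡n : val π k ≡ suc m
  πk≡n = proj₂ (maximum-attained {π = π} π-perm)
  πj<n : val π j < suc m
  πj<n = ≤∧≢⇒< (Fin.toℕ<n (lookup π j)) πj≢n
  k≢i : k ≢ i
  k≢i refl = <-irrefl πk≡n (<-trans values< πj<n)
  k≢j : k ≢ j
  k≢j refl = πj≢n πk≡n
  a : Fin 3
  a = proj₁ (column-cover k≢i k≢j)
  k∈column : T (inColumn i j a k)
  k∈column = proj₂ (column-cover k≢i k≢j)
  k∈topRow : T (inRow π i j two k)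
  k∈topRow = Equivalence.from T-btw
    (subst (val π j <_) (sym πk≡n) πj<n , subst (_< suc (suc m)) (sym πk≡n) ≤-refl)

shadedBoxesEmpty-transport : ∀ {R R′} {π π′ : Word n} {i j i′ j′}
  (τ : Fin n → Fin n) (α β : Fin 3 → Fin 3) → (∀ a b → R′ a b ≡ R (α a) (β b)) →
  (∀ a k → T (inColumn i′ j′ a k) → T (inColumn i j (α a) (τ k))) →
  (∀ b k → T (inRow π′ i′ j′ b k) → T (inRow π i j (β b) (τ k))) →
  ShadedBoxesEmpty R π i j → ShadedBoxesEmpty R′ π′ i′ j′
shadedBoxesEmpty-transport {π′ = π′} {i′ = i′} {j′} τ α β R′≡ columns rows empty a b R′ab k k∈box =
  empty (α a) (β b) (subst T (R′≡ a b) R′ab) (τ k)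
    (Equivalence.from T-∧ (columns a k k∈column , rows b k k∈row))
  where
  k∈column : T (inColumn i′ j′ a k)
  k∈column = proj₁ (Equivalence.to (T-∧ {inColumn i′ j′ a k}) k∈box)
  k∈row : T (inRow π′ i′ j′ b k)
  k∈row = proj₂ (Equivalence.to (T-∧ {inColumn i′ j′ a k}) k∈box)

complementValue : Fin n → Fin n
complementValue {suc m} = reflectBelow (fromℕ m)

complement : Word n → Word n
complement = Vec.map complementValue

val-complement : (π : Word n) (k : Fin n) → val (complement π) k ≡ reflect n (val π k)
val-complement {suc m} π k = begin
  pos (lookup (complement π) k)             ≡⟨ cong pos (Vecₚ.lookup-map k complementValue π) ⟩
  pos (reflectBelow (fromℕ m) (lookup π k)) ≡⟨ pos-reflectBelow (fromℕ m) (lookup π k) ⟩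
  reflect (pos (fromℕ m)) (val π k)         ≡⟨ cong (λ t → reflect (suc t) (val π k)) (Fin.toℕ-fromℕ m) ⟩
  reflect (suc m) (val π k)                 ∎
  where open ≡-Reasoning

complementValue-involutive : (x : Fin n) → complementValue (complementValue x) ≡ x
complementValue-involutive {suc m} = reflectBelow-involutive (fromℕ m)

complement-involutive : (π : Word n) → complement (complement π) ≡ π
complement-involutive π = begin
  complement (complement π)                       ≡⟨ Vecₚ.map-∘ complementValue complementValue π ⟨
  Vec.map (complementValue ∘′ complementValue) π  ≡⟨ Vecₚ.map-cong complementValue-involutive π ⟩
  Vec.map id π                                    ≡⟨ Vecₚ.map-id π ⟩
  π                                               ∎
  where open ≡-Reasoning

complement-permutation : (π : Word n) → IsPermutation π → IsPermutation (complement π)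
complement-permutation π π-perm {i} {j} π′i≡π′j =
  π-perm (involutive⇒injective complementValue complementValue-involutive (begin
    complementValue (lookup π i)  ≡⟨ Vecₚ.lookup-map i complementValue π ⟨
    lookup (complement π) i       ≡⟨ π′i≡π′j ⟩
    lookup (complement π) j       ≡⟨ Vecₚ.lookup-map j complementValue π ⟩
    complementValue (lookup π j)  ∎))
  where open ≡-Reasoning

complement-occurrence : ∀ {R R′} (π : Word n) {i j} → topShaded R →
  (∀ a b → R′ a b ≡ R a (flip01 b)) → IsPermutation π →
  Occurrence R π i j → Occurrence R′ (complement π) i j
complement-occurrence {n} {R} {R′} π {i} {j} top R′≡ π-perm occurrence = record
  { positions<  = positions<
  ; values<     = subst₂ _<_ (sym π′i≡) (sym π′j≡n) (∸-monoʳ-< z<s (<⇒≤ πi<n))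
  ; shadedEmpty = shadedBoxesEmpty-transport {π = π} {complement π} {i} {j} {i} {j}
                    id id flip01 R′≡ (λ _ _ → id) rows shadedEmpty
  }
  where
  open Occurrence occurrence
  πj≡n : val π j ≡ n
  πj≡n = occurrence⇒maximum top π-perm occurrence
  πi<n : val π i < n
  πi<n = subst (val π i <_) πj≡n values<
  π′i≡ : val (complement π) i ≡ n ∸ val π i
  π′i≡ = trans (val-complement π i) (reflect-< πi<n)
  π′j≡n : val (complement π) j ≡ n
  π′j≡n = trans (val-complement π j) (trans (reflect-≥ (≤-reflexive (sym πj≡n))) πj≡n)
  rows : ∀ b k → T (inRow (complement π) i j b k) → T (inRow π i j (flip01 b) k)
  rows b k k∈row =
    subst T (band-cong n (flip01 b) refl (sym πj≡n) (reflect-involutive n z<s)) reflected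
    where
    reflected : T (band n (val π i) n (flip01 b) (reflect n (reflect n (val π k))))
    reflected = band-reflect b πi<n
      (subst T (band-cong n b (val-complement π i) π′j≡n (val-complement π k)) k∈row)

reversePrefix : Fin n → Word n → Word n
reversePrefix p π = tabulate (lookup π ∘′ reflectBelow p)

lookup-reversePrefix : (p : Fin n) (π : Word n) (k : Fin n) →
                       lookup (reversePrefix p π) k ≡ lookup π (reflectBelow p k)
lookup-reversePrefix p π = Vecₚ.lookup∘tabulate (lookup π ∘′ reflectBelow p)

val-reversePrefix : (p : Fin n) (π : Word n) (k : Fin n) →
                    val (reversePrefix p π) k ≡ val π (reflectBelow p k)
val-reversePrefix p π k = cong pos (lookup-reversePrefix p π k)

val-reversePrefix-self : (p : Fin n) (π : Word n) → val (reversePrefix p π) p ≡ val π p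
val-reversePrefix-self p π = trans (val-reversePrefix p π p) (cong (val π) (reflectBelow-self p))

reversePrefix-involutive : (p : Fin n) (π : Word n) → reversePrefix p (reversePrefix p π) ≡ π
reversePrefix-involutive p π = trans
  (Vecₚ.tabulate-cong λ k → trans (lookup-reversePrefix p π (reflectBelow p k))
                                  (cong (lookup π) (reflectBelow-involutive p k)))
  (Vecₚ.tabulate∘lookup π)

reversePrefix-permutation : (p : Fin n) (π : Word n) →
                            IsPermutation π → IsPermutation (reversePrefix p π)
reversePrefix-permutation p π π-perm {i} {j} π′i≡π′j =
  involutive⇒injective (reflectBelow p) (reflectBelow-involutive p) (π-perm (begin
    lookup π (reflectBelow p i)   ≡⟨ lookup-reversePrefix p π i ⟨
    lookup (reversePrefix p π) i  ≡⟨ π′i≡π′j ⟩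
    lookup (reversePrefix p π) j  ≡⟨ lookup-reversePrefix p π j ⟩
    lookup π (reflectBelow p j)   ∎))
  where open ≡-Reasoning

reversePrefix-occurrence : ∀ {R R′} (p : Fin n) (π : Word n) {i j} → topShaded R →
  (∀ a b → R′ a b ≡ R (flip01 a) b) → IsPermutation π → val π p ≡ n →
  Occurrence R π i j → Occurrence R′ (reversePrefix p π) (reflectBelow p i) (reflectBelow p j)
reversePrefix-occurrence {n} {R} {R′} p π {i} {j} top R′≡ π-perm πp≡n occurrence
  -- the occurrence ends at p, the position of the maximum
  with refl ← π-perm (pos-injective (trans (occurrence⇒maximum top π-perm occurrence) (sym πp≡n)))
  rewrite reflectBelow-self p = record
  { positions<  = reflectBelow-< p i positions<
  ; values<     = subst₂ _<_ (sym π′i′≡πi) (sym (val-reversePrefix-self p π)) values<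
  ; shadedEmpty = shadedBoxesEmpty-transport {π = π} {π′} {i} {p} {reflectBelow p i} {p}
                    (reflectBelow p) flip01 id R′≡ columns rows shadedEmpty
  }
  where
  open Occurrence occurrence
  π′ : Word n
  π′ = reversePrefix p π
  π′i′≡πi : val π′ (reflectBelow p i) ≡ val π i
  π′i′≡πi = trans (val-reversePrefix p π _) (cong (val π) (reflectBelow-involutive p i))
  columns : ∀ a k → T (inColumn (reflectBelow p i) p a k) →
                    T (inColumn i p (flip01 a) (reflectBelow p k))
  columns a k k∈column = subst T (band-cong n (flip01 a) refl refl (sym (pos-reflectBelow p k)))
    (band-reflect a positions<
      (subst T (band-cong n a (pos-reflectBelow p i) refl refl) k∈column))
  rows : ∀ b k → T (inRow π′ (reflectBelow p i) p b k) → T (inRow π i p b (reflectBelow p k))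
  rows b k = subst T (band-cong n b π′i′≡πi (val-reversePrefix-self p π) (val-reversePrefix p π k))

maximumPosition? : (π : Word n) → Dec (∃ λ p → val π p ≡ n)
maximumPosition? {n} π = Fin.any? (λ p → val π p ≟ n)

reverseBeforeMaximum : Word n → Word n
reverseBeforeMaximum π with maximumPosition? π
... | yes (p , _) = reversePrefix p π
... | no _        = π

reverseBeforeMaximum-spec : (π : Word n) (p : Fin n) → IsPermutation π → val π p ≡ n →
                            reverseBeforeMaximum π ≡ reversePrefix p π
reverseBeforeMaximum-spec π p π-perm πp≡n with maximumPosition? π
... | yes (q , πq≡n) =
  cong (λ r → reversePrefix r π) (π-perm (pos-injective (trans πq≡n (sym πp≡n))))
... | no none        = contradiction (p , πp≡n) none

reverseBeforeMaximum-none : (π : Word n) → ¬ (∃ λ p → val π p ≡ n) → reverseBeforeMaximum π ≡ π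
reverseBeforeMaximum-none π none with maximumPosition? π
... | yes hit = contradiction hit none
... | no _    = refl

reverseBeforeMaximum-permutation : (π : Word n) →
                                   IsPermutation π → IsPermutation (reverseBeforeMaximum π)
reverseBeforeMaximum-permutation π π-perm with maximumPosition? π
... | yes (p , _) = reversePrefix-permutation p π π-perm
... | no _        = π-perm

reverseBeforeMaximum-involutive : (π : Word n) → IsPermutation π →
                                  reverseBeforeMaximum (reverseBeforeMaximum π) ≡ π
reverseBeforeMaximum-involutive π π-perm with maximumPosition? π
... | yes (p , πp≡n) = trans
  (reverseBeforeMaximum-spec (reversePrefix p π) p (reversePrefix-permutation p π π-perm)
    (trans (val-reversePrefix-self p π) πp≡n))
  (reversePrefix-involutive p π)
... | no none = reverseBeforeMaximum-none π none

occ-≡-by-involution : ∀ {R R′} {π π′ : Word n} (τ : Fin n → Fin n) → (∀ k → τ (τ k) ≡ k) →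
  (∀ {i j} → Occurrence R π i j ⇔ Occurrence R′ π′ (τ i) (τ j)) → occ R π ≡ occ R′ π′
occ-≡-by-involution {n} τ τ-involutive R⇔R′ =
  length-filter-involution _ _ {Product.map τ τ} (allPairs-unique n)
    (λ { {i , j} _ → ∈-allPairs (τ i) (τ j) })
    (λ { {i , j} _ → cong₂ _,_ (τ-involutive i) (τ-involutive j) })
    (λ { {i , j} _ → ⇔-sym occurs ⇔-∘ (R⇔R′ ⇔-∘ occurs) })
  where
  occurs : ∀ {R} {π : Word n} {i j} → isOcc R π i j ≡ true ⇔ Occurrence R π i j
  occurs = isOcc⇔Occurrence ⇔-∘ ⇔-sym T-≡

equidistributed-by-involution : ∀ {R R′} (f : ∀ {n} → Word n → Word n) →
  (∀ {n} (π : Word n) → IsPermutation π → IsPermutation (f π)) →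
  (∀ {n} (π : Word n) → IsPermutation π → f (f π) ≡ π) →
  (∀ {n} (π : Word n) → IsPermutation π → occ R π ≡ occ R′ (f π)) →
  Equidistributed R R′
equidistributed-by-involution f f-permutation f-involutive occ-f n k =
  length-filter-involution _ _ {f} (perms-unique n)
    (λ {π} π∈ → ∈-perms⁺ (f-permutation π (∈-perms⁻ π∈)))
    (λ {π} π∈ → f-involutive π (∈-perms⁻ π∈))
    (λ {π} π∈ → mk⇔ (trans (sym (occ-f π (∈-perms⁻ π∈)))) (trans (occ-f π (∈-perms⁻ π∈))))

R′-flipsRows : ∀ {R} → topShaded R → ∀ a b → R′ R a b ≡ R a (flip01 b)
R′-flipsRows top a zero             = refl
R′-flipsRows top a (suc zero)       = refl
R′-flipsRows top a (suc (suc zero)) = sym (top a)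

R″-flipsColumns : ∀ {R} → topShaded R → R two zero ≡ false → R two (suc zero) ≡ false →
                  ∀ a b → R″ R a b ≡ R (flip01 a) b
R″-flipsColumns top R20 R21 a                (suc (suc zero)) = sym (top (flip01 a))
R″-flipsColumns top R20 R21 zero             zero             = refl
R″-flipsColumns top R20 R21 zero             (suc zero)       = refl
R″-flipsColumns top R20 R21 (suc zero)       zero             = refl
R″-flipsColumns top R20 R21 (suc zero)       (suc zero)       = refl
R″-flipsColumns top R20 R21 (suc (suc zero)) zero             = sym R20
R″-flipsColumns top R20 R21 (suc (suc zero)) (suc zero)       = sym R21

occ-complement : ∀ R → topShaded R → (π : Word n) → IsPermutation π →
                 occ R π ≡ occ (R′ R) (complement π)
occ-complement R top π π-perm = occ-≡-by-involution id (λ _ → refl) (mk⇔ forward backward)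
  where
  forward : ∀ {i j} → Occurrence R π i j → Occurrence (R′ R) (complement π) i j
  forward = complement-occurrence π top (R′-flipsRows top) π-perm
  unflip : ∀ a b → R a b ≡ R′ R a (flip01 b)
  unflip a b = sym (trans (R′-flipsRows top a (flip01 b)) (cong (R a) (flip01-involutive b)))
  backward : ∀ {i j} → Occurrence (R′ R) (complement π) i j → Occurrence R π i j
  backward {i} {j} occurrence = subst (λ ρ → Occurrence R ρ i j) (complement-involutive π)
    (complement-occurrence (complement π) (λ _ → refl) unflip
      (complement-permutation π π-perm) occurrence)

occ-reverseBeforeMaximum : ∀ R → topShaded R → R two zero ≡ false → R two (suc zero) ≡ false →
  (π : Word n) → IsPermutation π → occ R π ≡ occ (R″ R) (reverseBeforeMaximum π)
occ-reverseBeforeMaximum {zero}  R top R20 R21 π π-perm = refl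
occ-reverseBeforeMaximum {suc m} R top R20 R21 π π-perm
  with p , πp≡n ← maximum-attained {π = π} π-perm
  rewrite reverseBeforeMaximum-spec π p π-perm πp≡n =
  occ-≡-by-involution (reflectBelow p) (reflectBelow-involutive p) (mk⇔ forward backward)
  where
  π′ : Word (suc m)
  π′ = reversePrefix p π
  forward : ∀ {i j} → Occurrence R π i j →
            Occurrence (R″ R) π′ (reflectBelow p i) (reflectBelow p j)
  forward = reversePrefix-occurrence p π top (R″-flipsColumns top R20 R21) π-perm πp≡n
  unflip : ∀ a b → R a b ≡ R″ R (flip01 a) b
  unflip a b = sym (trans (R″-flipsColumns top R20 R21 (flip01 a) b)
                          (cong (λ c → R c b) (flip01-involutive a)))
  backward : ∀ {i j} → Occurrence (R″ R) π′ (reflectBelow p i) (reflectBelow p j) →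
             Occurrence R π i j
  backward {i} {j} occurrence =
    subst (λ ρ → Occurrence R ρ i j) (reversePrefix-involutive p π)
      (subst₂ (Occurrence R (reversePrefix p π′))
              (reflectBelow-involutive p i) (reflectBelow-involutive p j)
        (reversePrefix-occurrence p π′ (λ _ → refl) unflip
          (reversePrefix-permutation p π π-perm) (trans (val-reversePrefix-self p π) πp≡n)
          occurrence))

lemma3p1 : (R : Shading) → topShaded R →
    Equidistributed R (R′ R)
    × (R two zero ≡ false → R two (suc zero) ≡ false → Equidistributed R (R″ R))
lemma3p1 R top =
  equidistributed-by-involution {R} {R′ R} complement complement-permutation
    (λ π _ → complement-involutive π) (occ-complement R top) ,
  λ R20 R21 → equidistributed-by-involution {R} {R″ R} reverseBeforeMaximum
    reverseBeforeMaximum-permutation reverseBeforeMaximum-involutive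
    (occ-reverseBeforeMaximum R top R20 R21)
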